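{- $\mathsf{LinExp}$ is effectively closed under taking minima: for all $h,h'\in\mathsf{LinExp}$ one can compute a linear expectation $h''\in\mathsf{LinExp}$ with $h''(\sigma)=\min\{h(\sigma),h'(\sigma)\}$ for every state $\sigma$.
   Context: Program variables form a finite set $\mathsf{Vars}$; a state is a map $\sigma\colon\mathsf{Vars}\to\mathbb{N}$. Linear expressions: $e::= r\mid x\mid r\cdot e\mid e+e\mid e\mathbin{\dot- }e$ with $r\in\mathbb{Q}_{\ge0}$, $x\in\mathsf{Vars}$, where $\dot-$ is subtraction truncated at $0$. Extended linear expressions: $\tilde e::= e\mid\infty$. Linear guards: $\varphi::= e<e\mid\varphi\wedge\varphi\mid\neg\varphi$ (with $e$ linear expressions, no $\infty$). Linear expectations $\mathsf{LinExp}$: $h::=\tilde e\mid[\varphi]\cdot h\mid h+h$, evaluated on states pointwise (values in $\mathbb{R}_{\ge0}\cup\{\infty\}$) with $[\varphi](\sigma)\in\{0,1\}$ the truth value of $\varphi$, $0\cdot\infty=0$ and $a+\infty=\infty$. -}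

module Defs where

open import Data.Nat using (ℕ)
open import Data.Fin using (Fin)
open import Data.Bool using (Bool; true; false; if_then_else_; _∧_; not)
open import Data.Integer using (+_)
open import Data.Rational using (ℚ; 0ℚ; _≤_; _+_; _-_; _*_; _⊔_; _⊓_; _≤ᵇ_; _/_)

State : ℕ → Set
State n = Fin n → ℕ

data LinExpr (n : ℕ) : Set where
  const : (r : ℚ) → 0ℚ ≤ r → LinExpr n
  var   : Fin n → LinExpr n
  scale : (r : ℚ) → 0ℚ ≤ r → LinExpr n → LinExpr n
  plus  : LinExpr n → LinExpr n → LinExpr n
  monus : LinExpr n → LinExpr n → LinExpr n

data ExtLinExpr (n : ℕ) : Set where
  fin : LinExpr n → ExtLinExpr n
  inf : ExtLinExpr n

data Guard (n : ℕ) : Set where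
  lt  : LinExpr n → LinExpr n → Guard n
  and : Guard n → Guard n → Guard n
  neg : Guard n → Guard n

data LinExp (n : ℕ) : Set where
  ext   : ExtLinExpr n → LinExp n
  iver  : Guard n → LinExp n → LinExp n
  plusE : LinExp n → LinExp n → LinExp n

-- Values: ℚ (non-negative in practice) extended with ∞
data ℚ∞ : Set where
  val : ℚ → ℚ∞
  ∞   : ℚ∞

_+∞_ : ℚ∞ → ℚ∞ → ℚ∞
val a +∞ val b = val (a + b)
val _ +∞ ∞     = ∞
∞     +∞ _     = ∞

min∞ : ℚ∞ → ℚ∞ → ℚ∞
min∞ (val a) (val b) = val (a ⊓ b)
min∞ (val a) ∞       = val a
min∞ ∞       y       = y

_∸ℚ_ : ℚ → ℚ → ℚ
a ∸ℚ b = (a - b) ⊔ 0ℚ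

ℕ→ℚ : ℕ → ℚ
ℕ→ℚ k = (+ k) / 1

⟦_⟧e : ∀ {n} → LinExpr n → State n → ℚ
⟦ const r _ ⟧e σ   = r
⟦ var x ⟧e σ       = ℕ→ℚ (σ x)
⟦ scale r _ e ⟧e σ = r * ⟦ e ⟧e σ
⟦ plus e e' ⟧e σ   = ⟦ e ⟧e σ + ⟦ e' ⟧e σ
⟦ monus e e' ⟧e σ  = ⟦ e ⟧e σ ∸ℚ ⟦ e' ⟧e σ

⟦_⟧ẽ : ∀ {n} → ExtLinExpr n → State n → ℚ∞
⟦ fin e ⟧ẽ σ = val (⟦ e ⟧e σ)
⟦ inf ⟧ẽ σ   = ∞

⟦_⟧g : ∀ {n} → Guard n → State n → Bool
⟦ lt e e' ⟧g σ = not (⟦ e' ⟧e σ ≤ᵇ ⟦ e ⟧e σ)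
⟦ and φ ψ ⟧g σ = ⟦ φ ⟧g σ ∧ ⟦ ψ ⟧g σ
⟦ neg φ ⟧g σ   = not (⟦ φ ⟧g σ)

-- [φ]·h with 0·∞ = 0
⟦_⟧ : ∀ {n} → LinExp n → State n → ℚ∞
⟦ ext e ⟧ σ      = ⟦ e ⟧ẽ σ
⟦ iver φ h ⟧ σ   = if ⟦ φ ⟧g σ then ⟦ h ⟧ σ else val 0ℚ
⟦ plusE h h' ⟧ σ = ⟦ h ⟧ σ +∞ ⟦ h' ⟧ σ

{-# OPTIONS --safe #-}
module Submission where

-- Every linear expectation is equivalent to a decision tree whose inner nodes
-- test linear guards and whose leaves are extended linear expressions: [φ]·t
-- becomes the node "φ ? t : 0", and a sum of two trees is obtained by grafting
-- the second tree below every leaf of the first and adding the leaves pairwise.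
-- The minimum of two trees is built the same way, replacing each pair of
-- finite leaves e, e' by the node "e' < e ? e' : e".  Finally a tree is read
-- back as the linear expectation [φ]·t + [¬φ]·u at each node.

open import Defs
open import Data.Nat using (ℕ)
open import Data.Bool using (true; false; if_then_else_; not)
open import Data.Product using (Σ; _,_)
open import Data.Rational using (ℚ; 0ℚ; _≤ᵇ_; _⊓_)
open import Data.Rational.Properties using (≤-refl; +-identityˡ; +-identityʳ)
open import Relation.Binary.PropositionalEquality using (_≡_; refl; cong; cong₂; module ≡-Reasoning)

data DecTree (n : ℕ) : Set where
  leaf : ExtLinExpr n → DecTree n
  node : Guard n → DecTree n → DecTree n → DecTree n

⟦_⟧ᵗ : ∀ {n} → DecTree n → State n → ℚ∞
⟦ leaf e ⟧ᵗ σ     = ⟦ e ⟧ẽ σ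
⟦ node φ t u ⟧ᵗ σ = if ⟦ φ ⟧g σ then ⟦ t ⟧ᵗ σ else ⟦ u ⟧ᵗ σ

+∞-identityˡ : (x : ℚ∞) → val 0ℚ +∞ x ≡ x
+∞-identityˡ (val a) = cong val (+-identityˡ a)
+∞-identityˡ ∞       = refl

+∞-identityʳ : (x : ℚ∞) → x +∞ val 0ℚ ≡ x
+∞-identityʳ (val a) = cong val (+-identityʳ a)
+∞-identityʳ ∞       = refl

toLinExp : ∀ {n} → DecTree n → LinExp n
toLinExp (leaf e)     = ext e
toLinExp (node φ t u) = plusE (iver φ (toLinExp t)) (iver (neg φ) (toLinExp u))

toLinExp-sound : ∀ {n} (t : DecTree n) (σ : State n) → ⟦ toLinExp t ⟧ σ ≡ ⟦ t ⟧ᵗ σ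
toLinExp-sound (leaf e)     σ = refl
toLinExp-sound (node φ t u) σ with ⟦ φ ⟧g σ
... | true  rewrite +∞-identityʳ (⟦ toLinExp t ⟧ σ) = toLinExp-sound t σ
... | false rewrite +∞-identityˡ (⟦ toLinExp u ⟧ σ) = toLinExp-sound u σ

zipLeavesWith : ∀ {n} → (ExtLinExpr n → ExtLinExpr n → DecTree n) →
                DecTree n → DecTree n → DecTree n
zipLeavesWith f (node φ t u) s            = node φ (zipLeavesWith f t s) (zipLeavesWith f u s)
zipLeavesWith f (leaf e)     (node φ t u) = node φ (zipLeavesWith f (leaf e) t) (zipLeavesWith f (leaf e) u)
zipLeavesWith f (leaf e)     (leaf e')    = f e e'

zipLeavesWith-sound : ∀ {n} (f : ExtLinExpr n → ExtLinExpr n → DecTree n) (_∙_ : ℚ∞ → ℚ∞ → ℚ∞) →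
  (∀ e e' σ → ⟦ f e e' ⟧ᵗ σ ≡ ⟦ e ⟧ẽ σ ∙ ⟦ e' ⟧ẽ σ) →
  ∀ t s σ → ⟦ zipLeavesWith f t s ⟧ᵗ σ ≡ ⟦ t ⟧ᵗ σ ∙ ⟦ s ⟧ᵗ σ
zipLeavesWith-sound f _∙_ f-sound (node φ t u) s σ with ⟦ φ ⟧g σ
... | true  = zipLeavesWith-sound f _∙_ f-sound t s σ
... | false = zipLeavesWith-sound f _∙_ f-sound u s σ
zipLeavesWith-sound f _∙_ f-sound (leaf e) (node φ t u) σ with ⟦ φ ⟧g σ
... | true  = zipLeavesWith-sound f _∙_ f-sound (leaf e) t σ
... | false = zipLeavesWith-sound f _∙_ f-sound (leaf e) u σ
zipLeavesWith-sound f _∙_ f-sound (leaf e) (leaf e') σ = f-sound e e' σ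

addLeaves : ∀ {n} → ExtLinExpr n → ExtLinExpr n → DecTree n
addLeaves (fin e) (fin e') = leaf (fin (plus e e'))
addLeaves (fin e) inf      = leaf inf
addLeaves inf     _        = leaf inf

addLeaves-sound : ∀ {n} (e e' : ExtLinExpr n) (σ : State n) →
                  ⟦ addLeaves e e' ⟧ᵗ σ ≡ ⟦ e ⟧ẽ σ +∞ ⟦ e' ⟧ẽ σ
addLeaves-sound (fin e) (fin e') σ = refl
addLeaves-sound (fin e) inf      σ = refl
addLeaves-sound inf     _        σ = refl

-- Both sides unfold to the same test p ≤ᵇ q once p and q are eta-expanded.
if-≤ᵇ≡⊓ : (p q : ℚ) → (if not (p ≤ᵇ q) then val q else val p) ≡ val (p ⊓ q)
if-≤ᵇ≡⊓ p@record{} q@record{} with p ≤ᵇ q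
... | true  = refl
... | false = refl

minLeaves : ∀ {n} → ExtLinExpr n → ExtLinExpr n → DecTree n
minLeaves (fin e) (fin e') = node (lt e' e) (leaf (fin e')) (leaf (fin e))
minLeaves (fin e) inf      = leaf (fin e)
minLeaves inf     e'       = leaf e'

minLeaves-sound : ∀ {n} (e e' : ExtLinExpr n) (σ : State n) →
                  ⟦ minLeaves e e' ⟧ᵗ σ ≡ min∞ (⟦ e ⟧ẽ σ) (⟦ e' ⟧ẽ σ)
minLeaves-sound (fin e) (fin e') σ = if-≤ᵇ≡⊓ (⟦ e ⟧e σ) (⟦ e' ⟧e σ)
minLeaves-sound (fin e) inf      σ = refl
minLeaves-sound inf     e'       σ = refl

toDecTree : ∀ {n} → LinExp n → DecTree n
toDecTree (ext e)      = leaf e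
toDecTree (iver φ h)   = node φ (toDecTree h) (leaf (fin (const 0ℚ ≤-refl)))
toDecTree (plusE h h') = zipLeavesWith addLeaves (toDecTree h) (toDecTree h')

toDecTree-sound : ∀ {n} (h : LinExp n) (σ : State n) → ⟦ toDecTree h ⟧ᵗ σ ≡ ⟦ h ⟧ σ
toDecTree-sound (ext e)      σ = refl
toDecTree-sound (iver φ h)   σ with ⟦ φ ⟧g σ
... | true  = toDecTree-sound h σ
... | false = refl
toDecTree-sound (plusE h h') σ = begin
  ⟦ zipLeavesWith addLeaves (toDecTree h) (toDecTree h') ⟧ᵗ σ
    ≡⟨ zipLeavesWith-sound addLeaves _+∞_ addLeaves-sound (toDecTree h) (toDecTree h') σ ⟩
  ⟦ toDecTree h ⟧ᵗ σ +∞ ⟦ toDecTree h' ⟧ᵗ σ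
    ≡⟨ cong₂ _+∞_ (toDecTree-sound h σ) (toDecTree-sound h' σ) ⟩
  ⟦ h ⟧ σ +∞ ⟦ h' ⟧ σ ∎
  where open ≡-Reasoning

theorem8 : (n : ℕ) (h h' : LinExp n) →
    Σ (LinExp n) (λ h'' → (σ : State n) → ⟦ h'' ⟧ σ ≡ min∞ (⟦ h ⟧ σ) (⟦ h' ⟧ σ))
theorem8 n h h' = toLinExp minTree , λ σ → begin
  ⟦ toLinExp minTree ⟧ σ
    ≡⟨ toLinExp-sound minTree σ ⟩
  ⟦ minTree ⟧ᵗ σ
    ≡⟨ zipLeavesWith-sound minLeaves min∞ minLeaves-sound (toDecTree h) (toDecTree h') σ ⟩
  min∞ (⟦ toDecTree h ⟧ᵗ σ) (⟦ toDecTree h' ⟧ᵗ σ)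
    ≡⟨ cong₂ min∞ (toDecTree-sound h σ) (toDecTree-sound h' σ) ⟩
  min∞ (⟦ h ⟧ σ) (⟦ h' ⟧ σ) ∎
  where
  open ≡-Reasoning
  minTree : DecTree n
  minTree = zipLeavesWith minLeaves (toDecTree h) (toDecTree h')
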